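{- Let $X$ be a set and $R\subseteq X\times X$. (i) If $R$ is irreflexive then the protection relation $\sqsupset_R$ is consistent. (ii) The converse does not hold in general: there exist a set $X$ and a relation $R$ on $X$ such that $\sqsupset_R$ is consistent but $R$ is not irreflexive.
   Context: $R$ is irreflexive iff $\forall x\in X.\ \neg xRx$. The protection relation induced by $R$ is defined by $x \sqsupset_R z$ iff $\forall y\in X\,(yRz \Rightarrow xRy)$. $\sqsupset_R$ is consistent iff $\forall x,y\in X\,(x\sqsupset_R y \Rightarrow \neg xRy)$. -}

module Defs where

open import Level using (Level; _⊔_)
open import Relation.Binary.Core using (Rel)
open import Relation.Nullary using (¬_)

IrreflexiveRel : ∀ {a ℓ} {X : Set a} → Rel X ℓ → Set (a ⊔ ℓ)
IrreflexiveRel {X = X} R = ∀ (x : X) → ¬ R x x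

Protects : ∀ {a ℓ} {X : Set a} → Rel X ℓ → Rel X (a ⊔ ℓ)
Protects {X = X} R x z = ∀ (y : X) → R y z → R x y

ProtectionConsistent : ∀ {a ℓ} {X : Set a} → Rel X ℓ → Set (a ⊔ ℓ)
ProtectionConsistent {X = X} R = ∀ (x y : X) → Protects R x y → ¬ R x y

module Submission where

open import Defs
open import Level using (0ℓ)
open import Data.Product using (_×_; Σ; _,_)
open import Data.Bool using (Bool; true; false; T)
open import Data.Unit using (tt)
open import Relation.Binary.Core using (Rel)
open import Relation.Nullary using (¬_)

irreflexive⇒protectionConsistent : ∀ {a ℓ} {X : Set a} {R : Rel X ℓ} →
                                   IrreflexiveRel R → ProtectionConsistent R
irreflexive⇒protectionConsistent irr x y x⊐y xRy = irr x (x⊐y x xRy)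

pointsToTrue : Rel Bool 0ℓ
pointsToTrue _ z = T z

-- Since false R true, anything protecting true would be R-related to false, and nothing is.
pointsToTrue-protectionConsistent : ProtectionConsistent pointsToTrue
pointsToTrue-protectionConsistent x true x⊐true _ = x⊐true false tt

pointsToTrue-notIrreflexive : ¬ IrreflexiveRel pointsToTrue
pointsToTrue-notIrreflexive irr = irr true tt

mainTheorem5 : ((X : Set) (R : Rel X 0ℓ) → IrreflexiveRel R → ProtectionConsistent R)
    × Σ Set (λ X → Σ (Rel X 0ℓ) (λ R → ProtectionConsistent R × ¬ IrreflexiveRel R))
mainTheorem5 =
    (λ _ _ → irreflexive⇒protectionConsistent)
  , Bool , pointsToTrue , pointsToTrue-protectionConsistent , pointsToTrue-notIrreflexive
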